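{- Let $k\ge 2$. For a uniformly random palindrome $w$ of length $m$ over a $k$-letter alphabet, the probability that all borders of $w$ other than $w$ itself have length less than $\lfloor\log_k m\rfloor$ tends to $1$ as $m\to\infty$.
   Context: A word $u$ is a border of $w$ if $u$ is both a prefix and a suffix of $w$. A palindrome is a word equal to its reversal. -}

module Defs where

open import Data.Nat using (ℕ; zero; suc; _<_; _<?_)
open import Data.Fin using (Fin)
import Data.Fin.Properties as FinP
open import Data.List using (List; []; _∷_; [_]; length; reverse; map; concatMap; allFin; filter; inits)
open import Data.List.Properties using (≡-dec)
open import Data.List.Membership.Propositional using (_∈_)
open import Data.List.Membership.Propositional.Properties using (∈-map⁺; ∈-map⁻)
open import Data.List.Relation.Unary.Any using (here; there)
open import Data.List.Relation.Unary.All using (All; all?)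
import Data.List.Relation.Unary.All as All
open import Data.List.Relation.Binary.Prefix.Heterogeneous using (Prefix; []; _∷_)
open import Data.List.Relation.Binary.Prefix.Heterogeneous.Properties using (prefix?)
open import Data.List.Relation.Binary.Suffix.Heterogeneous using (Suffix)
open import Data.List.Relation.Binary.Suffix.Heterogeneous.Properties using (suffix?)
open import Data.Product using (_×_; _,_; proj₁; proj₂)
open import Relation.Binary.PropositionalEquality using (_≡_; _≢_; refl)
open import Relation.Nullary using (Dec; yes; no; ¬_)
open import Relation.Nullary.Decidable using (_×-dec_; _→-dec_; map′; ¬?)

Word : ℕ → Set
Word k = List (Fin k)

words : (k m : ℕ) → List (Word k)
words k zero    = [ [] ]
words k (suc m) = concatMap (λ w → map (_∷ w) (allFin k)) (words k m)

Palindrome : ∀ {k} → Word k → Set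
Palindrome w = reverse w ≡ w

IsBorder : ∀ {k} → Word k → Word k → Set
IsBorder u w = Prefix _≡_ u w × Suffix _≡_ u w

ShortBorders : ∀ {k} → ℕ → Word k → Set
ShortBorders L w = ∀ u → IsBorder u w → u ≢ w → length u < L

_≟w_ : ∀ {k} (u v : Word k) → Dec (u ≡ v)
_≟w_ = ≡-dec FinP._≟_

palindrome? : ∀ {k} (w : Word k) → Dec (Palindrome w)
palindrome? w = reverse w ≟w w

private
  prefix⇒∈inits : ∀ {k} {u w : Word k} → Prefix _≡_ u w → u ∈ inits w
  prefix⇒∈inits []              = here refl
  prefix⇒∈inits (refl ∷ p) = there (∈-map⁺ _ (prefix⇒∈inits p))

  ∈inits⇒prefix : ∀ {k} {u : Word k} (w : Word k) → u ∈ inits w → Prefix _≡_ u w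
  ∈inits⇒prefix w (here refl) = []
  ∈inits⇒prefix (a ∷ w) (there p) with ∈-map⁻ (a ∷_) {xs = inits w} p
  ... | v , v∈ , refl = refl ∷ ∈inits⇒prefix w v∈

  Cond : ∀ {k} → ℕ → Word k → Word k → Set
  Cond L w u = Suffix _≡_ u w → ¬ (u ≡ w) → length u < L

  cond? : ∀ {k} L (w u : Word k) → Dec (Cond L w u)
  cond? L w u = suffix? _≟w'_ u w →-dec (¬? (u ≟w w) →-dec (length u <? L))
    where _≟w'_ = FinP._≟_

shortBorders? : ∀ {k} L (w : Word k) → Dec (ShortBorders L w)
shortBorders? L w = map′ to from (all? (cond? L w) (inits w))
  where
  to : All (Cond L w) (inits w) → ShortBorders L w
  to a u (p , s) u≢w = All.lookup a (prefix⇒∈inits p) s u≢w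
  from : ShortBorders L w → All (Cond L w) (inits w)
  from sb = All.tabulate λ {u} u∈ s u≢w → sb u (∈inits⇒prefix w u∈ , s) u≢w

#palindromes : (k m : ℕ) → ℕ
#palindromes k m = length (filter palindrome? (words k m))

#goodPalindromes : (k m L : ℕ) → ℕ
#goodPalindromes k m L =
  length (filter (λ w → palindrome? w ×-dec shortBorders? L w) (words k m))

-- Probability as a rational number: #favourable / #total
-- (the total is never 0 here; the 0 case is a junk value).

open import Data.Integer using (+_)
open import Data.Rational using (ℚ; _/_; 0ℚ)

ratio : ℕ → ℕ → ℚ
ratio g zero    = 0ℚ
ratio g (suc t) = (+ g) / suc t

probShortBorders : (k m L : ℕ) → ℚ
probShortBorders k m L = ratio (#goodPalindromes k m L) (#palindromes k m)

module Submission where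

-- A palindrome of length m is determined by its first h = ⌈ m /2⌉ letters, so
-- there are at least k ^ h of them.  A proper border of a palindrome w is a
-- palindromic prefix of w; if it has length at least L and 3L ≤ m, reflecting
-- it inside w yields a palindromic prefix of length j with L ≤ j ≤ m - L.
-- Such a prefix halves the freedom once more: w is then determined by a
-- window of h - ⌊ t /2⌋ letters, where t is j or m - j, whichever is at most
-- m/2.  So the bad palindromes lie in an explicit list of decodings of windows
-- whose length is a geometric sum below 4 · k ^ (h - ⌊ L /2⌋ + 1), and they
-- form less than a fraction 4k / k ^ ⌊ L /2⌋ of all palindromes, which tends
-- to 0 since L grows with m.

open import Defs
open import Data.Nat using (ℕ; suc; _≤_; _<_; _^_)
open import Data.Product using (∃)
open import Data.Rational using (ℚ; 0ℚ; 1ℚ; _-_; ∣_∣)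
import Data.Rational as Q

open import Data.Nat
  using (zero; z≤n; s≤s; z<s; _+_; _*_; _∸_; _⊓_; _⊔_; _<?_; _≤?_; ⌊_/2⌋; ⌈_/2⌉)
open import Data.Nat.Properties
open import Data.Nat.Induction using (<-rec)
open import Data.Nat.Tactic.RingSolver using (solve-∀)
open import Data.Fin using (Fin)
import Data.Fin as Fin
open import Data.Maybe using (Maybe; just; nothing; fromMaybe)
open import Data.Maybe.Properties using (just-injective)
open import Data.List
  using (List; []; _∷_; _++_; [_]; length; reverse; map; concatMap; allFin; filter; applyUpTo; downFrom)
open import Data.List.Properties
  using (length-++; length-map; length-tabulate; length-reverse; unfold-reverse; length-applyUpTo)
open import Data.List.Membership.Propositional using (_∈_; find; lose)
open import Data.List.Membership.Propositional.Properties
  using (∈-map⁺; ∈-map⁻; ∈-++⁻; ∈-++⁺ˡ; ∈-++⁺ʳ; ∈-∃++; ∈-allFin; ∈-concatMap⁺; ∈-concatMap⁻;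
         ∈-filter⁺; ∈-filter⁻; ∈-downFrom⁺)
open import Data.List.Relation.Unary.Any using (here; there)
import Data.List.Relation.Unary.All as All
import Data.List.Relation.Unary.All.Properties as All
open import Data.List.Relation.Unary.AllPairs using ([]; _∷_)
open import Data.List.Relation.Unary.Unique.Propositional using (Unique)
import Data.List.Relation.Unary.Unique.Propositional.Properties as Unique
open import Data.List.Relation.Binary.Prefix.Heterogeneous using (Prefix; []; _∷_)
open import Data.List.Relation.Binary.Prefix.Heterogeneous.Properties using (length-mono; toPointwise)
open import Data.List.Relation.Binary.Suffix.Heterogeneous using (Suffix; here; there)
open import Data.List.Relation.Binary.Pointwise using (Pointwise-≡⇒≡)
open import Data.Product using (_×_; _,_)
open import Data.Sum using (_⊎_; inj₁; inj₂)
open import Data.Empty using (⊥-elim)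
open import Level using (Level)
open import Relation.Binary.PropositionalEquality hiding ([_])
open import Relation.Nullary using (yes; no; ¬_)
open import Relation.Nullary.Decidable using (_×-dec_; ¬?)
open import Relation.Unary using (Pred; Decidable)

mirror-exists : ∀ {i m} → i < m → suc (i + (m ∸ suc i)) ≡ m
mirror-exists i<m = m+[n∸m]≡n i<m

mirror-unique : ∀ {i s m} → suc (i + s) ≡ m → m ∸ suc i ≡ s
mirror-unique {i} {s} refl = m+n∸m≡n i s

mirror-< : ∀ {i s m} → suc (i + s) ≡ m → s < m
mirror-< {i} {s} eq = subst (s <_) eq (s≤s (m≤n+m s i))

double≤ : ∀ {k} → 2 ≤ k → ∀ x → x + x ≤ k * x
double≤ {k} 2≤k x = subst (_≤ k * x) (cong (x +_) (+-identityʳ x)) (*-monoˡ-≤ x 2≤k)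

n<k^n : ∀ {k} → 2 ≤ k → ∀ n → n < k ^ n
n<k^n 2≤k zero    = s≤s z≤n
n<k^n {k@(suc _)} 2≤k (suc n) = ≤-trans (+-mono-≤ (m^n>0 k n) (n<k^n 2≤k n)) (double≤ 2≤k (k ^ n))

3n≤k^n : ∀ {k} → 2 ≤ k → ∀ n → 4 ≤ n → 3 * n ≤ k ^ n
3n≤k^n {k} 2≤k n 4≤n = subst (λ x → 3 * x ≤ k ^ x) (m+[n∸m]≡n 4≤n) (from4 (n ∸ 4))
  where
  from4 : ∀ n → 3 * (4 + n) ≤ k ^ (4 + n)
  from4 zero    = ≤-trans (m≤m+n 12 4) (^-monoˡ-≤ 4 2≤k)
  from4 (suc n) = begin
    3 * (5 + n)                   ≡⟨ step n ⟩
    3 * (4 + n) + 3               ≤⟨ +-mono-≤ (from4 n) (≤-trans (m≤m*n 3 (4 + n)) (from4 n)) ⟩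
    k ^ (4 + n) + k ^ (4 + n)     ≤⟨ double≤ 2≤k (k ^ (4 + n)) ⟩
    k ^ (5 + n)                   ∎
    where
    open ≤-Reasoning
    step : ∀ n → 3 * (5 + n) ≡ 3 * (4 + n) + 3
    step = solve-∀

halves : ∀ t → t ≡ ⌊ t /2⌋ + ⌊ t /2⌋ ⊎ t ≡ suc (⌊ t /2⌋ + ⌊ t /2⌋)
halves zero          = inj₁ refl
halves (suc zero)    = inj₂ refl
halves (suc (suc t)) with halves t
... | inj₁ eq = inj₁ (cong suc (trans (cong suc eq) (sym (+-suc ⌊ t /2⌋ ⌊ t /2⌋))))
... | inj₂ eq = inj₂ (cong suc (trans (cong suc eq) (cong suc (sym (+-suc ⌊ t /2⌋ ⌊ t /2⌋)))))

⌈/2⌉+⌊/2⌋≤⌈+/2⌉ : ∀ x y → ⌈ x /2⌉ + ⌊ y /2⌋ ≤ ⌈ x + y /2⌉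
⌈/2⌉+⌊/2⌋≤⌈+/2⌉ zero          y = ⌊n/2⌋≤⌈n/2⌉ y
⌈/2⌉+⌊/2⌋≤⌈+/2⌉ (suc zero)    y = ≤-refl
⌈/2⌉+⌊/2⌋≤⌈+/2⌉ (suc (suc x)) y = s≤s (⌈/2⌉+⌊/2⌋≤⌈+/2⌉ x y)

infixl 20 _!_

_!_ : {A : Set} → List A → ℕ → Maybe A
[]       ! i     = nothing
(x ∷ xs) ! zero  = just x
(x ∷ xs) ! suc i = xs ! i

!-ext : {A : Set} (xs ys : List A) → (∀ i → xs ! i ≡ ys ! i) → xs ≡ ys
!-ext []       []       _  = refl
!-ext []       (y ∷ ys) eq with () ← eq 0
!-ext (x ∷ xs) []       eq with () ← eq 0
!-ext (x ∷ xs) (y ∷ ys) eq =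
  cong₂ _∷_ (just-injective (eq 0)) (!-ext xs ys (λ i → eq (suc i)))

!-beyond : {A : Set} (xs : List A) {i : ℕ} → length xs ≤ i → xs ! i ≡ nothing
!-beyond []       _         = refl
!-beyond (x ∷ xs) (s≤s len) = !-beyond xs len

!-within : {A : Set} (xs : List A) {i : ℕ} → i < length xs → ∃ λ a → xs ! i ≡ just a
!-within (x ∷ xs) {zero}  _       = x , refl
!-within (x ∷ xs) {suc i} (s≤s p) = !-within xs p

!-++ˡ : {A : Set} (xs ys : List A) {i : ℕ} → i < length xs → (xs ++ ys) ! i ≡ xs ! i
!-++ˡ (x ∷ xs) ys {zero}  _       = refl
!-++ˡ (x ∷ xs) ys {suc i} (s≤s p) = !-++ˡ xs ys p

!-++ʳ : {A : Set} (xs ys : List A) (i : ℕ) → (xs ++ ys) ! (length xs + i) ≡ ys ! i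
!-++ʳ []       ys i = refl
!-++ʳ (x ∷ xs) ys i = !-++ʳ xs ys i

!-applyUpTo : {A : Set} (f : ℕ → A) {n i : ℕ} → i < n → applyUpTo f n ! i ≡ just (f i)
!-applyUpTo f {suc n} {zero}  _       = refl
!-applyUpTo f {suc n} {suc i} (s≤s p) = !-applyUpTo (λ t → f (suc t)) p

!-reverse : {A : Set} (xs : List A) {i s : ℕ} → suc (i + s) ≡ length xs →
            reverse xs ! i ≡ xs ! s
!-reverse (x ∷ xs) {i} {zero} eq rewrite unfold-reverse x xs =
  trans (cong ((reverse xs ++ [ x ]) !_) i≡) (!-++ʳ (reverse xs) [ x ] 0)
  where
  i≡ : i ≡ length (reverse xs) + 0
  i≡ = begin
    i                        ≡⟨ sym (+-identityʳ i) ⟩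
    i + 0                    ≡⟨ suc-injective eq ⟩
    length xs                ≡⟨ sym (length-reverse xs) ⟩
    length (reverse xs)      ≡⟨ sym (+-identityʳ _) ⟩
    length (reverse xs) + 0  ∎
    where open ≡-Reasoning
!-reverse (x ∷ xs) {i} {suc s} eq rewrite unfold-reverse x xs =
  trans (!-++ˡ (reverse xs) [ x ] i<len) (!-reverse xs (trans (sym (+-suc i s)) eq′))
  where
  eq′ : i + suc s ≡ length xs
  eq′ = suc-injective eq
  i<len : i < length (reverse xs)
  i<len = subst (i <_) (trans eq′ (sym (length-reverse xs))) (m<m+n i z<s)

-- The prefix of length j is a palindrome: entries at mirror positions i, s
-- (those with i + s + 1 = j) agree.
PalPrefix : {A : Set} → List A → ℕ → Set
PalPrefix w j = ∀ {i s} → suc (i + s) ≡ j → w ! i ≡ w ! s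

palindrome⇒PalPrefix : {A : Set} {w : List A} → reverse w ≡ w → PalPrefix w (length w)
palindrome⇒PalPrefix {w = w} pal {i} eq = trans (cong (_! i) (sym pal)) (!-reverse w eq)

prefix-! : {A : Set} {u w : List A} → Prefix _≡_ u w → ∀ {i} → i < length u → u ! i ≡ w ! i
prefix-! (refl ∷ pre) {zero}  _       = refl
prefix-! (refl ∷ pre) {suc i} (s≤s p) = prefix-! pre p

suffix-offset : {A : Set} {u w : List A} → Suffix _≡_ u w →
                ∃ λ c → c + length u ≡ length w × ∀ i → u ! i ≡ w ! (c + i)
suffix-offset (here eq) rewrite Pointwise-≡⇒≡ eq = 0 , refl , λ i → refl
suffix-offset (there suf) with c , len , at ← suffix-offset suf = suc c , cong suc len , at

-- A border of a palindrome is a palindromic prefix: the letter at i reappears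
-- at offset c + i in the suffix copy, and the mirror image of c + i in w is s.
border⇒PalPrefix : {A : Set} {u w : List A} → reverse w ≡ w →
                   Prefix _≡_ u w → Suffix _≡_ u w → PalPrefix w (length u)
border⇒PalPrefix {u = u} {w} pal pre suf {i} {s} eq with c , len , at ← suffix-offset suf =
  begin
    w ! i        ≡⟨ sym (prefix-! pre (subst (i <_) eq (s≤s (m≤m+n i s)))) ⟩
    u ! i        ≡⟨ at i ⟩
    w ! (c + i)  ≡⟨ palindrome⇒PalPrefix pal (trans (shift c i s) (trans (cong (c +_) eq) len)) ⟩
    w ! s        ∎
  where
  open ≡-Reasoning
  shift : ∀ c i s → suc (c + i + s) ≡ c + suc (i + s)
  shift = solve-∀

reflect : {A : Set} {w : List A} {p d : ℕ} →
          PalPrefix w (p + d + p) → PalPrefix w (p + d) → PalPrefix w d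
reflect {w = w} {p} big mid {i} {s} refl =
  begin
    w ! i        ≡⟨ mid (left p i s) ⟩
    w ! (p + s)  ≡⟨ big (outer p i s) ⟩
    w ! (p + i)  ≡⟨ sym (mid (right p i s)) ⟩
    w ! s        ∎
  where
  open ≡-Reasoning
  left : ∀ p i s → suc (i + (p + s)) ≡ p + suc (i + s)
  left = solve-∀
  outer : ∀ p i s → suc (p + s + (p + i)) ≡ p + suc (i + s) + p
  outer = solve-∀
  right : ∀ p i s → suc (s + (p + i)) ≡ p + suc (i + s)
  right = solve-∀

BalancedPalPrefix : {A : Set} → List A → ℕ → ℕ → Set
BalancedPalPrefix w L m = ∃ λ j → PalPrefix w j × L ≤ j × j + L ≤ m

-- If 3L ≤ m, a palindromic prefix of length j ∈ [L, m) of a palindrome of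
-- length m yields a balanced one: while j + L > m, the overhang p = m - j is
-- shorter than L, and reflecting gives the palindromic prefix of length
-- d = j - p, still at least L because m = p + d + p < 2L + d.
balanced : {A : Set} (w : List A) {L m : ℕ} → 3 * L ≤ m → PalPrefix w m →
           ∀ j → PalPrefix w j → L ≤ j → j < m → BalancedPalPrefix w L m
balanced w {L} {m} 3L≤m palm = <-rec Shrinks step
  where
  Shrinks : ℕ → Set
  Shrinks j = PalPrefix w j → L ≤ j → j < m → BalancedPalPrefix w L m
  step : ∀ j → (∀ {d} → d < j → Shrinks d) → Shrinks j
  step j rec palj L≤j j<m with j + L ≤? m
  ... | yes fits = j , palj , L≤j , fits
  ... | no overlong = rec d<j pald L≤d (<-trans d<j j<m)
    where
    p = m ∸ j
    j+p≡m : j + p ≡ m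
    j+p≡m = m+[n∸m]≡n (<⇒≤ j<m)
    p<L : p < L
    p<L = +-cancelˡ-< j p L (subst (_< j + L) (sym j+p≡m) (≰⇒> overlong))
    d = j ∸ p
    p+d≡j : p + d ≡ j
    p+d≡j = m+[n∸m]≡n (≤-trans (<⇒≤ p<L) L≤j)
    p+d+p≡m : p + d + p ≡ m
    p+d+p≡m = trans (cong (_+ p) p+d≡j) j+p≡m
    pald : PalPrefix w d
    pald = reflect {w = w} (subst (PalPrefix w) (sym p+d+p≡m) palm) (subst (PalPrefix w) (sym p+d≡j) palj)
    L≤d : L ≤ d
    L≤d = ≮⇒≥ λ d<L → <⇒≱ (subst₂ _<_ p+d+p≡m (triple L) (+-mono-< (+-mono-< p<L d<L) p<L)) 3L≤m
      where
      triple : ∀ L → L + L + L ≡ 3 * L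
      triple = solve-∀
    0<p : 0 < p
    0<p = n≢0⇒n>0 λ p≡0 → <-irrefl (trans (sym (+-identityʳ j)) (subst (λ x → j + x ≡ m) p≡0 j+p≡m)) j<m
    d<j : d < j
    d<j = subst (d <_) (trans (+-comm d p) p+d≡j) (m<m+n d 0<p)

just-fromMaybe : {A : Set} (z : A) (xs : List A) {i : ℕ} → i < length xs →
                 just (fromMaybe z (xs ! i)) ≡ xs ! i
just-fromMaybe z xs i< with a , eq ← !-within xs i< rewrite eq = refl

applyUpTo-palindrome : {A : Set} (f : ℕ → A) (n : ℕ) →
                       (∀ {i s} → suc (i + s) ≡ n → f i ≡ f s) →
                       reverse (applyUpTo f n) ≡ applyUpTo f n
applyUpTo-palindrome f n sym-f = !-ext _ _ entry
  where
  len : length (applyUpTo f n) ≡ n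
  len = length-applyUpTo f n
  entry : ∀ i → reverse (applyUpTo f n) ! i ≡ applyUpTo f n ! i
  entry i with i <? n
  ... | yes i<n = begin
    reverse (applyUpTo f n) ! i  ≡⟨ !-reverse (applyUpTo f n) (trans (mirror-exists i<n) (sym len)) ⟩
    applyUpTo f n ! (n ∸ suc i)  ≡⟨ !-applyUpTo f (mirror-< (mirror-exists i<n)) ⟩
    just (f (n ∸ suc i))         ≡⟨ cong just (sym (sym-f (mirror-exists i<n))) ⟩
    just (f i)                   ≡⟨ sym (!-applyUpTo f i<n) ⟩
    applyUpTo f n ! i            ∎
    where open ≡-Reasoning
  ... | no i≮n = trans (!-beyond (reverse (applyUpTo f n)) (subst (_≤ i) (sym len-rev) (≮⇒≥ i≮n)))
                       (sym (!-beyond (applyUpTo f n) (subst (_≤ i) (sym len) (≮⇒≥ i≮n))))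
    where
    len-rev : length (reverse (applyUpTo f n)) ≡ n
    len-rev = trans (length-reverse (applyUpTo f n)) len

-- Reflecting a position r through a palindromic prefix of length j: r is sent
-- to the larger of r and its mirror image j - 1 - r (and fixed when r ≥ j).
reflectThrough : ℕ → ℕ → ℕ
reflectThrough j r = r ⊔ (j ∸ suc r)

!-reflectThrough : {A : Set} {w : List A} {j : ℕ} → PalPrefix w j →
                   ∀ r → w ! r ≡ w ! reflectThrough j r
!-reflectThrough {w = w} {j} palj r with r <? j
... | no r≮j rewrite m≤n⇒m∸n≡0 (≤-trans (≮⇒≥ r≮j) (n≤1+n r)) | ⊔-identityʳ r = refl
... | yes r<j with ⊔-sel r (j ∸ suc r)
...   | inj₁ max≡r = cong (w !_) (sym max≡r)
...   | inj₂ max≡s = trans (palj (mirror-exists r<j)) (cong (w !_) (sym max≡s))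

reflectThrough-lower : ∀ j r → ⌊ j /2⌋ ≤ reflectThrough j r
reflectThrough-lower j r with r <? j
... | no r≮j = ≤-trans (≤-trans (⌊n/2⌋≤n j) (≮⇒≥ r≮j)) (m≤m⊔n r _)
... | yes r<j = begin
  ⌊ j /2⌋              ≤⟨ ⌊n/2⌋-mono j≤ ⟩
  ⌈ M + M /2⌉          ≡⟨ sym (n≡⌈n+n/2⌉ M) ⟩
  M                    ∎
  where
  open ≤-Reasoning
  M = reflectThrough j r
  j≤ : j ≤ suc (M + M)
  j≤ = subst (_≤ suc (M + M)) (mirror-exists r<j) (s≤s (+-mono-≤ (m≤m⊔n r _) (m≤n⊔m r _)))

reflectThrough-upper : ∀ {r b} j → r < b → reflectThrough j r < b ⊔ j
reflectThrough-upper {r} {b} zero    r<b =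
  ⊔-lub (≤-trans r<b (m≤m⊔n b 0)) (≤-trans (≤-trans (s≤s z≤n) r<b) (m≤m⊔n b 0))
reflectThrough-upper {r} {b} (suc j) r<b =
  ⊔-lub (≤-trans r<b (m≤m⊔n b _)) (≤-trans (s≤s (m∸n≤m j r)) (m≤n⊔m b _))

module Palindromes {A : Set} (z : A) (m : ℕ) where

  -- A palindrome of length m is determined by its first h letters.
  h : ℕ
  h = ⌈ m /2⌉

  m≤h+h : m ≤ h + h
  m≤h+h = subst (_≤ h + h) (⌊n/2⌋+⌈n/2⌉≡n m) (+-monoˡ-≤ h (⌊n/2⌋≤⌈n/2⌉ m))

  h+h≤1+m : h + h ≤ suc m
  h+h≤1+m = go m
    where
    go : ∀ n → ⌈ n /2⌉ + ⌈ n /2⌉ ≤ suc n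
    go zero          = z≤n
    go (suc zero)    = s≤s (s≤s z≤n)
    go (suc (suc n)) = s≤s (subst (_≤ suc (suc n)) (sym (+-suc ⌈ n /2⌉ ⌈ n /2⌉)) (s≤s (go n)))

  fold : ℕ → ℕ
  fold i = i ⊓ (m ∸ suc i)

  fold-symmetric : ∀ {i s} → suc (i + s) ≡ m → fold i ≡ fold s
  fold-symmetric {i} {s} eq = begin
    i ⊓ (m ∸ suc i)  ≡⟨ cong (i ⊓_) (mirror-unique eq) ⟩
    i ⊓ s            ≡⟨ ⊓-comm i s ⟩
    s ⊓ i            ≡⟨ cong (s ⊓_) (sym (mirror-unique (trans (cong suc (+-comm s i)) eq))) ⟩
    s ⊓ (m ∸ suc s)  ∎
    where open ≡-Reasoning

  fold-< : ∀ {i} → i < m → fold i < h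
  fold-< {i} i<m = ≰⇒> λ h≤f → <⇒≱ f+f<h+h (+-mono-≤ h≤f h≤f)
    where
    s = m ∸ suc i
    f+f<h+h : fold i + fold i < h + h
    f+f<h+h = ≤-<-trans (+-mono-≤ (m⊓n≤m i s) (m⊓n≤n i s))
                        (<-≤-trans (≤-reflexive (mirror-exists i<m)) m≤h+h)

  fold-id : ∀ {i} → i < h → fold i ≡ i
  fold-id {i} i<h = m≤n⇒m⊓n≡m (m+n≤o⇒m≤o∸n i (≤-pred (≤-trans (+-mono-≤ i<h i<h) h+h≤1+m)))

  !-fold : {w : List A} → PalPrefix w m → ∀ {i} → i < m → w ! i ≡ w ! fold i
  !-fold {w} palm {i} i<m with ⊓-sel i (m ∸ suc i)
  ... | inj₁ fold≡i = cong (w !_) (sym fold≡i)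
  ... | inj₂ fold≡s = trans (palm (mirror-exists i<m)) (cong (w !_) (sym fold≡s))

  mkPal : List A → List A
  mkPal x = applyUpTo (λ i → fromMaybe z (x ! fold i)) m

  length-mkPal : ∀ x → length (mkPal x) ≡ m
  length-mkPal x = length-applyUpTo _ m

  mkPal-palindrome : ∀ x → reverse (mkPal x) ≡ mkPal x
  mkPal-palindrome x = applyUpTo-palindrome _ m (λ eq → cong (λ i → fromMaybe z (x ! i)) (fold-symmetric eq))

  mkPal-injective : ∀ x y → length x ≡ h → length y ≡ h → mkPal x ≡ mkPal y → x ≡ y
  mkPal-injective x y lx ly eq = !-ext x y entry
    where
    firstHalf : ∀ v {i} → length v ≡ h → i < h → v ! i ≡ mkPal v ! i
    firstHalf v {i} lv i<h = begin
      v ! i                           ≡⟨ sym (just-fromMaybe z v (subst (i <_) (sym lv) i<h)) ⟩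
      just (fromMaybe z (v ! i))      ≡⟨ cong (λ n → just (fromMaybe z (v ! n))) (sym (fold-id i<h)) ⟩
      just (fromMaybe z (v ! fold i)) ≡⟨ sym (!-applyUpTo _ (<-≤-trans i<h (⌈n/2⌉≤n m))) ⟩
      mkPal v ! i                     ∎
      where open ≡-Reasoning
    entry : ∀ i → x ! i ≡ y ! i
    entry i with i <? h
    ... | yes i<h = trans (firstHalf x lx i<h) (trans (cong (_! i) eq) (sym (firstHalf y ly i<h)))
    ... | no i≮h = trans (!-beyond x (subst (_≤ i) (sym lx) (≮⇒≥ i≮h)))
                         (sym (!-beyond y (subst (_≤ i) (sym ly) (≮⇒≥ i≮h))))

  -- Where the letter at i is found again in a palindrome with a palindromic
  -- prefix of length j: fold into the first half, then reflect through the prefix.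
  anchor : ℕ → ℕ → ℕ
  anchor j i = reflectThrough j (fold i)

  window : ℕ → ℕ → List A → List A
  window a c w = applyUpTo (λ t → fromMaybe z (w ! (a + t))) c

  length-window : ∀ a c w → length (window a c w) ≡ c
  length-window a c w = length-applyUpTo _ c

  -- Rebuild a palindrome from the window that starts at the middle ⌊ j /2⌋
  -- of its palindromic prefix of length j.
  unwindow : ℕ → List A → List A
  unwindow j x = applyUpTo (λ i → fromMaybe z (x ! (anchor j i ∸ ⌊ j /2⌋))) m

  -- A palindrome of length m with a palindromic prefix of length j is
  -- determined by its letters at positions ⌊ j /2⌋ ≤ r < h ⊔ j.
  unwindow-window : ∀ {w j c} → length w ≡ m → PalPrefix w m → PalPrefix w j → j ≤ m →
                    h ≤ ⌊ j /2⌋ + c → j ≤ ⌊ j /2⌋ + c → unwindow j (window ⌊ j /2⌋ c w) ≡ w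
  unwindow-window {w} {j} {c} len palm palj j≤m h≤ j≤ = !-ext _ _ entry
    where
    a = ⌊ j /2⌋
    entry : ∀ i → unwindow j (window a c w) ! i ≡ w ! i
    entry i with i <? m
    ... | yes i<m = begin
      unwindow j (window a c w) ! i               ≡⟨ !-applyUpTo _ i<m ⟩
      just (fromMaybe z (window a c w ! (r ∸ a))) ≡⟨ cong (λ x → just (fromMaybe z x)) (!-applyUpTo _ r∸a<c) ⟩
      just (fromMaybe z (w ! (a + (r ∸ a))))      ≡⟨ cong (λ n → just (fromMaybe z (w ! n))) (m+[n∸m]≡n a≤r) ⟩
      just (fromMaybe z (w ! r))                  ≡⟨ just-fromMaybe z w (subst (r <_) (sym len) r<m) ⟩
      w ! r                                       ≡⟨ sym (!-reflectThrough {w = w} palj (fold i)) ⟩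
      w ! fold i                                  ≡⟨ sym (!-fold {w} palm i<m) ⟩
      w ! i                                       ∎
      where
      open ≡-Reasoning
      r = anchor j i
      a≤r : a ≤ r
      a≤r = reflectThrough-lower j (fold i)
      r<h⊔j : r < h ⊔ j
      r<h⊔j = reflectThrough-upper j (fold-< i<m)
      r∸a<c : r ∸ a < c
      r∸a<c = +-cancelˡ-< a _ c (subst (_< a + c) (sym (m+[n∸m]≡n a≤r)) (<-≤-trans r<h⊔j (⊔-lub h≤ j≤)))
      r<m : r < m
      r<m = <-≤-trans r<h⊔j (⊔-lub (⌈n/2⌉≤n m) j≤m)
    ... | no i≮m = trans (!-beyond (unwindow j (window a c w)) (subst (_≤ i) (sym (length-applyUpTo _ m)) (≮⇒≥ i≮m)))
                         (sym (!-beyond w (subst (_≤ i) (sym len) (≮⇒≥ i≮m))))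

unique-⊆⇒length-≤ : {A : Set} (xs ys : List A) → Unique xs → (∀ {v} → v ∈ xs → v ∈ ys) →
                    length xs ≤ length ys
unique-⊆⇒length-≤ []       ys _         _   = z≤n
unique-⊆⇒length-≤ (x ∷ xs) ys (x∉ ∷ uniq) sub with ys₁ , ys₂ , refl ← ∈-∃++ (sub (here refl)) =
  subst (suc (length xs) ≤_) (sym len) (s≤s (unique-⊆⇒length-≤ xs (ys₁ ++ ys₂) uniq sub′))
  where
  len : length (ys₁ ++ x ∷ ys₂) ≡ suc (length (ys₁ ++ ys₂))
  len = trans (length-++ ys₁) (trans (+-suc (length ys₁) (length ys₂)) (cong suc (sym (length-++ ys₁))))
  sub′ : ∀ {v} → v ∈ xs → v ∈ ys₁ ++ ys₂
  sub′ v∈xs with ∈-++⁻ ys₁ (sub (there v∈xs))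
  ... | inj₁ v∈ys₁         = ∈-++⁺ˡ v∈ys₁
  ... | inj₂ (here refl)   = ⊥-elim (All.lookup x∉ v∈xs refl)
  ... | inj₂ (there v∈ys₂) = ∈-++⁺ʳ ys₁ v∈ys₂

map-unique : {A B : Set} (f : A → B) (xs : List A) → Unique xs →
             (∀ {x y} → x ∈ xs → y ∈ xs → f x ≡ f y → x ≡ y) → Unique (map f xs)
map-unique f []       _           _   = []
map-unique f (x ∷ xs) (x∉ ∷ uniq) inj =
  All.map⁺ (All.tabulate λ y∈xs fx≡fy → All.lookup x∉ y∈xs (inj (here refl) (there y∈xs) fx≡fy))
  ∷ map-unique f xs uniq (λ p q → inj (there p) (there q))

length-filter-split : {A : Set} {p q : Level} {P : Pred A p} {Q : Pred A q}
                      (P? : Decidable P) (Q? : Decidable Q) (xs : List A) →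
  length (filter P? xs) ≡
  length (filter (λ x → P? x ×-dec Q? x) xs) + length (filter (λ x → P? x ×-dec ¬? (Q? x)) xs)
length-filter-split P? Q? []       = refl
length-filter-split P? Q? (x ∷ xs) with P? x | Q? x
... | yes _ | yes _ = cong suc (length-filter-split P? Q? xs)
... | yes _ | no _  = trans (cong suc (length-filter-split P? Q? xs)) (sym (+-suc _ _))
... | no _  | yes _ = length-filter-split P? Q? xs
... | no _  | no _  = length-filter-split P? Q? xs

extend : ∀ {k} → Word k → List (Word k)
extend {k} w = map (_∷ w) (allFin k)

length-words : ∀ k n → length (words k n) ≡ k ^ n
length-words k zero    = refl
length-words k (suc n) = begin
  length (concatMap extend (words k n)) ≡⟨ length-concatMap-const (words k n) ⟩
  length (words k n) * k                 ≡⟨ cong (_* k) (length-words k n) ⟩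
  k ^ n * k                              ≡⟨ *-comm (k ^ n) k ⟩
  k ^ suc n                              ∎
  where
  open ≡-Reasoning
  length-extend : ∀ w → length (extend {k} w) ≡ k
  length-extend w = trans (length-map (_∷ w) (allFin k)) (length-tabulate (λ i → i))
  length-concatMap-const : ∀ ws → length (concatMap extend ws) ≡ length ws * k
  length-concatMap-const []       = refl
  length-concatMap-const (w ∷ ws) =
    trans (length-++ (extend w)) (cong₂ _+_ (length-extend w) (length-concatMap-const ws))

words-complete : ∀ k n (v : Word k) → length v ≡ n → v ∈ words k n
words-complete k zero    []      _   = here refl
words-complete k (suc n) (a ∷ v) len =
  ∈-concatMap⁺ extend (lose (words-complete k n v (suc-injective len)) (∈-map⁺ (_∷ v) (∈-allFin a)))

words-sound : ∀ k n {v : Word k} → v ∈ words k n → length v ≡ n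
words-sound k zero    (here refl) = refl
words-sound k (suc n) v∈
  with w , w∈ , v∈ext ← find (∈-concatMap⁻ extend {xs = words k n} v∈)
  with _ , _ , refl ← ∈-map⁻ (_∷ w) v∈ext = cong suc (words-sound k n w∈)

words-unique : ∀ k n → Unique (words k n)
words-unique k zero    = All.[] ∷ []
words-unique k (suc n) = extend-all (words k n) (words-unique k n)
  where
  head-injective : ∀ {w : Word k} {a b} → a ∷ w ≡ b ∷ w → a ≡ b
  head-injective refl = refl
  extend-all : ∀ ws → Unique ws → Unique (concatMap extend ws)
  extend-all []       _           = []
  extend-all (w ∷ ws) (w∉ ∷ uniq) =
    Unique.++⁺ (Unique.map⁺ head-injective (Unique.allFin⁺ k)) (extend-all ws uniq) disjoint
    where
    disjoint : ∀ {v} → ¬ (v ∈ extend w × v ∈ concatMap extend ws)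
    disjoint (v∈w , v∈ws)
      with _ , _ , refl ← ∈-map⁻ (_∷ w) v∈w
      with w′ , w′∈ , v∈w′ ← find (∈-concatMap⁻ extend {xs = ws} v∈ws)
      with _ , _ , refl ← ∈-map⁻ (_∷ w′) v∈w′ = All.lookup w∉ w′∈ refl

length-concatMap-geometric : {B : Set} {k c : ℕ} → 2 ≤ k → 0 < c → (G : ℕ → List B) →
  (∀ e → length (G e) ≤ c * k ^ e) → ∀ n → length (concatMap G (downFrom n)) < c * k ^ n
length-concatMap-geometric {k = k} {c} 2≤k 0<c G bound zero =
  subst (0 <_) (sym (*-identityʳ c)) 0<c
length-concatMap-geometric {k = k} {c} 2≤k 0<c G bound (suc n) = begin-strict
  length (G n ++ concatMap G (downFrom n))           ≡⟨ length-++ (G n) ⟩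
  length (G n) + length (concatMap G (downFrom n))   <⟨ +-mono-≤-< (bound n) (length-concatMap-geometric 2≤k 0<c G bound n) ⟩
  c * k ^ n + c * k ^ n                              ≤⟨ double≤ 2≤k (c * k ^ n) ⟩
  k * (c * k ^ n)                                    ≡⟨ reorder c k (k ^ n) ⟩
  c * (k * k ^ n)                                    ∎
  where
  open ≤-Reasoning
  reorder : ∀ c k x → k * (c * x) ≡ c * (k * x)
  reorder = solve-∀

module Proportions where

  open import Data.Integer as ℤ using (+_; +[1+_]; -[1+_])
  import Data.Integer.Properties as ℤ
  import Data.Integer.Tactic.RingSolver as ℤ-Ring
  open import Data.Rational using (mkℚ; _/_; toℚᵘ)
  import Data.Rational.Properties as Q
  open import Data.Rational.Unnormalised as ℚᵘ using (mkℚᵘ; *≡*; *<*)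
  import Data.Rational.Unnormalised.Properties as ℚᵘ

  distance-from-one : ∀ g b t → g + b ≡ suc t → toℚᵘ ∣ 1ℚ - (+ g) / suc t ∣ ℚᵘ.≃ mkℚᵘ (+ b) t
  distance-from-one g b t g+b≡ = ℚᵘ.≃-trans (Q.toℚᵘ-homo-∣-∣ (1ℚ - x)) (ℚᵘ.∣-∣-cong difference)
    where
    open ≡-Reasoning
    x = (+ g) / suc t
    g+b≡ℤ : + suc t ≡ + g ℤ.+ + b
    g+b≡ℤ = trans (cong +_ (sym g+b≡)) (ℤ.pos-+ g b)
    cross : ∀ G B → (+ 1 ℤ.* (G ℤ.+ B) ℤ.+ ℤ.- G ℤ.* + 1) ℤ.* (G ℤ.+ B) ≡ B ℤ.* (G ℤ.+ B)
    cross = ℤ-Ring.solve-∀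
    one-times : + suc t ≡ + (1 * suc t)
    one-times = cong +_ (sym (*-identityˡ (suc t)))
    difference : toℚᵘ (1ℚ - x) ℚᵘ.≃ mkℚᵘ (+ b) t
    difference = ℚᵘ.≃-trans (Q.toℚᵘ-homo-+ 1ℚ (Q.- x))
      (ℚᵘ.≃-trans (ℚᵘ.+-cong (Q.toℚᵘ-fromℚᵘ ℚᵘ.1ℚᵘ)
                            (ℚᵘ.≃-trans (Q.toℚᵘ-homo‿- x) (ℚᵘ.-‿cong (Q.toℚᵘ-fromℚᵘ (mkℚᵘ (+ g) t)))))
                  (*≡* (begin
        (+ 1 ℤ.* + suc t ℤ.+ ℤ.- (+ g) ℤ.* + 1) ℤ.* + suc t  ≡⟨ cong (λ s → (+ 1 ℤ.* s ℤ.+ ℤ.- (+ g) ℤ.* + 1) ℤ.* s) g+b≡ℤ ⟩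
        (+ 1 ℤ.* (+ g ℤ.+ + b) ℤ.+ ℤ.- (+ g) ℤ.* + 1) ℤ.* (+ g ℤ.+ + b) ≡⟨ cross (+ g) (+ b) ⟩
        + b ℤ.* (+ g ℤ.+ + b)                                ≡⟨ cong (+ b ℤ.*_) (trans (sym g+b≡ℤ) one-times) ⟩
        + b ℤ.* + (1 * suc t)                                ∎)))

  small-fraction : ∀ b t (ε : ℚ) → 0ℚ Q.< ε → b * Q.↧ₙ ε < suc t → mkℚᵘ (+ b) t ℚᵘ.< toℚᵘ ε
  small-fraction b t (mkℚ (+ 0)      d _) 0<ε _ = ⊥-elim (ℤ.Positive.pos (Q.positive 0<ε))
  small-fraction b t (mkℚ -[1+ n ]   d _) 0<ε _ = ⊥-elim (ℤ.Positive.pos (Q.positive 0<ε))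
  small-fraction b t (mkℚ +[1+ n ]   d _) 0<ε b*d<t = *<* (subst₂ ℤ._<_ (ℤ.pos-* b (suc d)) (ℤ.pos-* (suc n) (suc t))
    (ℤ.+<+ (<-≤-trans b*d<t (m≤n*m (suc t) (suc n)))))

  ratio-close : ∀ g b t → g + b ≡ suc t → (ε : ℚ) → 0ℚ Q.< ε → b * Q.↧ₙ ε < suc t →
                ∣ 1ℚ - (+ g) / suc t ∣ Q.< ε
  ratio-close g b t g+b≡ ε 0<ε b*d<t = Q.toℚᵘ-cancel-<
    (ℚᵘ.<-respˡ-≃ (ℚᵘ.≃-sym (distance-from-one g b t g+b≡)) (small-fraction b t ε 0<ε b*d<t))

module Counting (k′ m L : ℕ) where

  k : ℕ
  k = suc (suc k′)

  open Palindromes {Fin k} Fin.zero m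
  open import Data.List.Membership.DecPropositional (_≟w_ {k}) using (_∈?_)

  -- There are at least k ^ h palindromes: mkPal is injective on words of length h.
  palindromes-lower : k ^ h ≤ #palindromes k m
  palindromes-lower = subst (_≤ #palindromes k m) (trans (length-map mkPal (words k h)) (length-words k h))
    (unique-⊆⇒length-≤ (map mkPal (words k h)) (filter palindrome? (words k m)) uniq sub)
    where
    uniq = map-unique mkPal (words k h) (words-unique k h)
             (λ p q → mkPal-injective _ _ (words-sound k h p) (words-sound k h q))
    sub : ∀ {v} → v ∈ map mkPal (words k h) → v ∈ filter palindrome? (words k m)
    sub v∈ with x , _ , refl ← ∈-map⁻ mkPal v∈ =
      ∈-filter⁺ palindrome? (words-complete k m (mkPal x) (length-mkPal x)) (mkPal-palindrome x)

  decodings : ℕ → ℕ → List (Word k)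
  decodings j c = map (unwindow j) (words k c)

  ∈-decodings : ∀ {w j} c → length w ≡ m → PalPrefix w m → PalPrefix w j → j ≤ m →
                h ≤ ⌊ j /2⌋ + c → j ≤ ⌊ j /2⌋ + c → w ∈ decodings j c
  ∈-decodings {w} {j} c len palm palj j≤m h≤ j≤ =
    subst (_∈ decodings j c) (unwindow-window {w} len palm palj j≤m h≤ j≤)
      (∈-map⁺ (unwindow j) (words-complete k c (window ⌊ j /2⌋ c w) (length-window ⌊ j /2⌋ c w)))

  -- Candidates with a palindromic prefix of length t or m - t, for t with ⌊ t /2⌋ = q,
  -- and all candidates with q ranging over ⌊ L /2⌋ ≤ q ≤ h.
  block : ℕ → List (Word k)
  block t = decodings t (h ∸ ⌊ t /2⌋) ++ decodings (m ∸ t) (h ∸ ⌊ t /2⌋)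

  pair : ℕ → List (Word k)
  pair q = block (q + q) ++ block (suc (q + q))

  candidates : List (Word k)
  candidates = concatMap (λ e → pair (h ∸ e)) (downFrom (suc (h ∸ ⌊ L /2⌋)))

  ∈-pair : ∀ t {v} → v ∈ block t → v ∈ pair ⌊ t /2⌋
  ∈-pair t v∈ with halves t
  ... | inj₁ eq = ∈-++⁺ˡ (subst (λ x → _ ∈ block x) eq v∈)
  ... | inj₂ eq = ∈-++⁺ʳ (block (⌊ t /2⌋ + ⌊ t /2⌋)) (subst (λ x → _ ∈ block x) eq v∈)

  ∈-candidates : ∀ q {v} → ⌊ L /2⌋ ≤ q → q ≤ h → v ∈ pair q → v ∈ candidates
  ∈-candidates q q₀≤q q≤h v∈ = ∈-concatMap⁺ (λ e → pair (h ∸ e))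
    (lose (∈-downFrom⁺ (s≤s (∸-monoʳ-≤ h q₀≤q))) (subst (λ x → _ ∈ pair x) (sym (m∸[m∸n]≡n q≤h)) v∈))

  length-block : ∀ t → length (block t) ≡ 2 * k ^ (h ∸ ⌊ t /2⌋)
  length-block t = begin
    length (decodings t c ++ decodings (m ∸ t) c)        ≡⟨ length-++ (decodings t c) ⟩
    length (decodings t c) + length (decodings (m ∸ t) c) ≡⟨ cong₂ _+_ (size t) (size (m ∸ t)) ⟩
    k ^ c + k ^ c                                         ≡⟨ cong (k ^ c +_) (sym (+-identityʳ (k ^ c))) ⟩
    2 * k ^ c                                             ∎
    where
    open ≡-Reasoning
    c = h ∸ ⌊ t /2⌋
    size : ∀ j → length (decodings j c) ≡ k ^ c
    size j = trans (length-map (unwindow j) (words k c)) (length-words k c)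

  length-pair : ∀ q → length (pair q) ≡ 4 * k ^ (h ∸ q)
  length-pair q = begin
    length (block (q + q) ++ block (suc (q + q)))            ≡⟨ length-++ (block (q + q)) ⟩
    length (block (q + q)) + length (block (suc (q + q)))    ≡⟨ cong₂ _+_ (length-block (q + q)) (length-block (suc (q + q))) ⟩
    2 * k ^ (h ∸ ⌊ q + q /2⌋) + 2 * k ^ (h ∸ ⌈ q + q /2⌉)    ≡⟨ cong₂ (λ a b → 2 * k ^ (h ∸ a) + 2 * k ^ (h ∸ b))
                                                                   (sym (n≡⌊n+n/2⌋ q)) (sym (n≡⌈n+n/2⌉ q)) ⟩
    2 * k ^ (h ∸ q) + 2 * k ^ (h ∸ q)                        ≡⟨ sym (*-distribʳ-+ (k ^ (h ∸ q)) 2 2) ⟩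
    4 * k ^ (h ∸ q)                                          ∎
    where open ≡-Reasoning

  length-candidates : length candidates < 4 * k ^ suc (h ∸ ⌊ L /2⌋)
  length-candidates =
    length-concatMap-geometric {k = k} {c = 4} (s≤s (s≤s z≤n)) (s≤s z≤n)
      (λ e → pair (h ∸ e)) bound (suc (h ∸ ⌊ L /2⌋))
    where
    bound : ∀ e → length (pair (h ∸ e)) ≤ 4 * k ^ e
    bound e = subst (_≤ 4 * k ^ e) (sym (length-pair (h ∸ e)))
      (*-monoʳ-≤ 4 (^-monoʳ-≤ k (m≤n+o⇒m∸n≤o h (h ∸ e) (subst (h ≤_) (+-comm e (h ∸ e)) (m≤n+m∸n h e)))))

  -- A palindrome with a balanced palindromic prefix of length j is a candidate:
  -- for j ≤ m/2 through the window of length h - ⌊ j /2⌋, and otherwise through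
  -- the window of length h - ⌊ t /2⌋ for the complementary length t = m - j.
  balanced⇒candidate : ∀ {w} → length w ≡ m → PalPrefix w m → BalancedPalPrefix w L m → w ∈ candidates
  balanced⇒candidate {w} len palm (j , palj , L≤j , j+L≤m) with j + j ≤? m
  ... | yes short = ∈-candidates q (⌊n/2⌋-mono L≤j) q≤h
                      (∈-pair j (∈-++⁺ˡ (∈-decodings c len palm palj j≤m h≤q+c j≤q+c)))
    where
    j≤m = ≤-trans (m≤m+n j L) j+L≤m
    q = ⌊ j /2⌋
    j≤h : j ≤ h
    j≤h = ≤-trans (≤-trans (≤-reflexive (n≡⌊n+n/2⌋ j)) (⌊n/2⌋-mono short)) (⌊n/2⌋≤⌈n/2⌉ m)
    q≤h = ≤-trans (⌊n/2⌋≤n j) j≤h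
    c = h ∸ q
    h≤q+c : h ≤ q + c
    h≤q+c = ≤-reflexive (sym (m+[n∸m]≡n q≤h))
    j≤q+c : j ≤ q + c
    j≤q+c = ≤-trans j≤h h≤q+c
  ... | no long = ∈-candidates q (⌊n/2⌋-mono L≤t) q≤h
                    (∈-pair t (∈-++⁺ʳ (decodings t c) (subst (λ x → w ∈ decodings x c) (sym m∸t≡j)
                      (∈-decodings c len palm palj j≤m h≤ j≤))))
    where
    j≤m = ≤-trans (m≤m+n j L) j+L≤m
    t = m ∸ j
    q = ⌊ t /2⌋
    L≤t : L ≤ t
    L≤t = m+n≤o⇒m≤o∸n L (subst (_≤ m) (+-comm j L) j+L≤m)
    m∸t≡j : m ∸ t ≡ j
    m∸t≡j = m∸[m∸n]≡n j≤m
    halves≤h : ⌈ j /2⌉ + q ≤ h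
    halves≤h = subst (λ x → ⌈ j /2⌉ + q ≤ ⌈ x /2⌉) (m+[n∸m]≡n j≤m) (⌈/2⌉+⌊/2⌋≤⌈+/2⌉ j t)
    q≤h = ≤-trans (m≤n+m q ⌈ j /2⌉) halves≤h
    c = h ∸ q
    j≤ : j ≤ ⌊ j /2⌋ + c
    j≤ = subst (_≤ ⌊ j /2⌋ + c) (⌊n/2⌋+⌈n/2⌉≡n j) (+-monoʳ-≤ ⌊ j /2⌋ (m+n≤o⇒m≤o∸n ⌈ j /2⌉ halves≤h))
    h≤ : h ≤ ⌊ j /2⌋ + c
    h≤ = ≤-trans (subst (h ≤_) (sym (n≡⌈n+n/2⌉ j)) (⌈n/2⌉-mono (<⇒≤ (≰⇒> long)))) j≤

  longBorder⇒candidate : 3 * L ≤ m → ∀ {w u} → length w ≡ m → Palindrome w →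
                         IsBorder u w → u ≢ w → L ≤ length u → w ∈ candidates
  longBorder⇒candidate 3L≤m {w} {u} len pal (pre , suf) u≢w L≤u =
    balanced⇒candidate len palm (balanced w 3L≤m palm (length u) (border⇒PalPrefix pal pre suf) L≤u u<m)
    where
    palm : PalPrefix w m
    palm = subst (PalPrefix w) len (palindrome⇒PalPrefix pal)
    u<m : length u < m
    u<m = subst (length u <_) len
            (≤∧≢⇒< (length-mono pre) (λ eq → u≢w (Pointwise-≡⇒≡ (toPointwise eq pre))))

  bad : List (Word k)
  bad = filter (λ w → palindrome? w ×-dec ¬? (shortBorders? L w)) (words k m)

  -- Every bad palindrome is a candidate.  Constructively: a palindrome that is
  -- not a candidate has only short proper borders, since a long one would make
  -- it a candidate.
  bad⊆candidates : 3 * L ≤ m → ∀ {w} → w ∈ bad → w ∈ candidates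
  bad⊆candidates 3L≤m {w} w∈ with ∈-filter⁻ (λ w → palindrome? w ×-dec ¬? (shortBorders? L w)) w∈
  ... | w∈words , pal , notShort with w ∈? candidates
  ...   | yes w∈c = w∈c
  ...   | no w∉c  = ⊥-elim (notShort short)
    where
    short : ShortBorders L w
    short u border u≢w with length u <? L
    ... | yes u<L = u<L
    ... | no u≮L = ⊥-elim (w∉c (longBorder⇒candidate 3L≤m (words-sound k m w∈words)
                                                     pal border u≢w (≮⇒≥ u≮L)))

  palindromes-split : #palindromes k m ≡ #goodPalindromes k m L + length bad
  palindromes-split = length-filter-split palindrome? (shortBorders? L) (words k m)

  bad-fraction : 3 * L ≤ m → length bad * k ^ ⌊ L /2⌋ < 4 * k * #palindromes k m
  bad-fraction 3L≤m = begin-strict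
    length bad * k ^ q₀                   ≤⟨ *-monoˡ-≤ (k ^ q₀) bad≤ ⟩
    length candidates * k ^ q₀            <⟨ *-monoˡ-< (k ^ q₀) {{m^n≢0 k q₀}} length-candidates ⟩
    4 * k ^ suc (h ∸ q₀) * k ^ q₀          ≡⟨ powers ⟩
    4 * k * k ^ h                         ≤⟨ *-monoʳ-≤ (4 * k) palindromes-lower ⟩
    4 * k * #palindromes k m              ∎
    where
    open ≤-Reasoning
    q₀ = ⌊ L /2⌋
    bad≤ : length bad ≤ length candidates
    bad≤ = unique-⊆⇒length-≤ bad candidates (Unique.filter⁺ _ (words-unique k m)) (bad⊆candidates 3L≤m)
    q₀≤h : q₀ ≤ h
    q₀≤h = ≤-trans (⌊n/2⌋-mono (≤-trans (m≤m+n L (L + (L + 0))) 3L≤m)) (⌊n/2⌋≤⌈n/2⌉ m)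
    powers : 4 * k ^ suc (h ∸ q₀) * k ^ q₀ ≡ 4 * k * k ^ h
    powers = begin-equality
      4 * k ^ suc (h ∸ q₀) * k ^ q₀    ≡⟨ *-assoc 4 (k ^ suc (h ∸ q₀)) (k ^ q₀) ⟩
      4 * (k ^ suc (h ∸ q₀) * k ^ q₀)  ≡⟨ cong (4 *_) (sym (^-distribˡ-+-* k (suc (h ∸ q₀)) q₀)) ⟩
      4 * k ^ (suc (h ∸ q₀) + q₀)      ≡⟨ cong (λ e → 4 * k ^ suc e) (m∸n+n≡m q₀≤h) ⟩
      4 * (k * k ^ h)                  ≡⟨ sym (*-assoc 4 k (k ^ h)) ⟩
      4 * k * k ^ h                    ∎

  probability-close : 3 * L ≤ m → (ε : ℚ) → 0ℚ Q.< ε → 4 * k * Q.↧ₙ ε ≤ k ^ ⌊ L /2⌋ →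
                      ∣ 1ℚ - probShortBorders k m L ∣ Q.< ε
  probability-close 3L≤m ε 0<ε small = close (#palindromes k m) palindromes-split bad·d<total
    where
    d = Q.↧ₙ ε
    good = #goodPalindromes k m L
    bad·d<total : length bad * d < #palindromes k m
    bad·d<total = *-cancelˡ-< (4 * k) _ _ (begin-strict
      4 * k * (length bad * d)   ≡⟨ swap (4 * k) (length bad) d ⟩
      length bad * (4 * k * d)   ≤⟨ *-monoʳ-≤ (length bad) small ⟩
      length bad * k ^ ⌊ L /2⌋   <⟨ bad-fraction 3L≤m ⟩
      4 * k * #palindromes k m   ∎)
      where
      open ≤-Reasoning
      swap : ∀ a b c → a * (b * c) ≡ b * (a * c)
      swap = solve-∀
    close : ∀ total → total ≡ good + length bad → length bad * d < total →
            ∣ 1ℚ - ratio good total ∣ Q.< ε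
    close zero    _     ()
    close (suc t) split lt = Proportions.ratio-close good (length bad) t (sym split) ε 0<ε lt

-- Choose M = k ^ E with E = 2C + 4 and C = 4k · ↧ε.  For m ≥ M, the condition
-- m < k ^ (L + 1) forces L ≥ E, so 3L ≤ k ^ L ≤ m and C ≤ ⌊ L /2⌋, whence
-- 4k · ↧ε = C < k ^ C ≤ k ^ ⌊ L /2⌋ and probability-close applies.
lemma8 : (k : ℕ) → 2 ≤ k →
         (ε : ℚ) → 0ℚ Q.< ε →
         ∃ λ M → ∀ m → M ≤ m → ∀ L → k ^ L ≤ m → m < k ^ suc L →
           ∣ 1ℚ - probShortBorders k m L ∣ Q.< ε
lemma8 k@(suc (suc k′)) 2≤k@(s≤s (s≤s z≤n)) ε 0<ε = k ^ E , close
  where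
  C = 4 * k * Q.↧ₙ ε
  E = C + C + 4
  close : ∀ m → k ^ E ≤ m → ∀ L → k ^ L ≤ m → m < k ^ suc L → ∣ 1ℚ - probShortBorders k m L ∣ Q.< ε
  close m kᴱ≤m L kᴸ≤m m<kᴸ⁺¹ = Counting.probability-close k′ m L 3L≤m ε 0<ε C≤kᴸᐟ²
    where
    E≤L : E ≤ L
    E≤L = ≮⇒≥ λ L<E → <⇒≱ m<kᴸ⁺¹ (≤-trans (^-monoʳ-≤ k L<E) kᴱ≤m)
    3L≤m : 3 * L ≤ m
    3L≤m = ≤-trans (3n≤k^n 2≤k L (≤-trans (m≤n+m 4 (C + C)) E≤L)) kᴸ≤m
    C≤L/2 : C ≤ ⌊ L /2⌋
    C≤L/2 = ≤-trans (≤-reflexive (n≡⌊n+n/2⌋ C)) (⌊n/2⌋-mono (≤-trans (m≤m+n (C + C) 4) E≤L))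
    C≤kᴸᐟ² : C ≤ k ^ ⌊ L /2⌋
    C≤kᴸᐟ² = ≤-trans (<⇒≤ (n<k^n 2≤k C)) (^-monoʳ-≤ k C≤L/2)
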